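{- Let $p$ be an atom and let $\phi$ be a unimodal formula in which $p$ does not occur. Define $\tau_p$ inductively by $\tau_p(q)=q$ for atoms $q$, $\tau_p(\bot)=\bot$, $\tau_p(\neg\psi)=\neg\tau_p(\psi)$, $\tau_p(\psi\vee\chi)=\tau_p(\psi)\vee\tau_p(\chi)$, $\tau_p(\square\psi)=\square(p\rightarrow\tau_p(\psi))$. Then the following are equivalent: (1) $\phi$ is valid in the class of all frames; (2) $\tau_p(\phi)$ is valid in the class of all frames; (3) $\tau_p(\phi)$ is valid in the class of all dense frames.
   Context: Unimodal formulas are built from atoms, $\bot$, $\neg$, $\vee$ and a box operator $\square$ (other connectives being abbreviations). A frame is a pair $(W,R)$ with $W$ nonempty and $R\subseteq W\times W$, with standard Kripke semantics. A frame is dense if whenever $sRt$ there exists $u$ with $sRu$ and $uRt$. A formula is valid in a class of frames if it is true at every world of every model based on a frame in the class. -}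

module Defs where

open import Data.Nat using (ℕ)
open import Data.Bool using (Bool; true)
open import Data.Empty using (⊥)
open import Data.Product using (_×_; Σ)
open import Data.Sum using (_⊎_)
open import Relation.Nullary using (¬_)
open import Relation.Binary.PropositionalEquality using (_≡_)

data Form : Set where
  atom : ℕ → Form
  ⊥'   : Form
  ¬'_  : Form → Form
  _∨'_ : Form → Form → Form
  □_   : Form → Form

_→'_ : Form → Form → Form
φ →' ψ = (¬' φ) ∨' ψ

Occurs : ℕ → Form → Set
Occurs p (atom q) = p ≡ q
Occurs p ⊥' = ⊥
Occurs p (¬' φ) = Occurs p φ
Occurs p (φ ∨' ψ) = Occurs p φ ⊎ Occurs p ψ
Occurs p (□ φ) = Occurs p φ

τ : ℕ → Form → Form
τ p (atom q) = atom q
τ p ⊥' = ⊥'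
τ p (¬' φ) = ¬' τ p φ
τ p (φ ∨' ψ) = τ p φ ∨' τ p ψ
τ p (□ φ) = □ (atom p →' τ p φ)

record Frame : Set₁ where
  field
    W : Set
    R : W → W → Set
    inhabited : W
open Frame public

Valuation : Frame → Set
Valuation F = W F → ℕ → Bool

-- Truth; disjunction is read classically so that truth is ¬¬-stable.
_,_,_⊨_ : (F : Frame) → Valuation F → W F → Form → Set
F , V , w ⊨ atom q = V w q ≡ true
F , V , w ⊨ ⊥' = ⊥
F , V , w ⊨ (¬' φ) = ¬ (F , V , w ⊨ φ)
F , V , w ⊨ (φ ∨' ψ) = ¬ (¬ (F , V , w ⊨ φ) × ¬ (F , V , w ⊨ ψ))
F , V , w ⊨ (□ φ) = (v : W F) → R F w v → F , V , v ⊨ φ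

ValidIn : Frame → Form → Set
ValidIn F φ = (V : Valuation F) (w : W F) → F , V , w ⊨ φ

Dense : Frame → Set
Dense F = ∀ {s t} → R F s t → Σ (W F) (λ u → R F s u × R F u t)

ValidAll : Form → Set₁
ValidAll φ = (F : Frame) → ValidIn F φ

ValidDense : Form → Set₁
ValidDense φ = (F : Frame) → Dense F → ValidIn F φ

-- Validity of φ transfers to τ_p φ by restricting every frame to the edges
-- that end in p-worlds, which turns the guard p →' _ into a tautology; back
-- from τ_p φ to φ by making p true everywhere, which is harmless since p does
-- not occur in φ. For density, add to any frame an apex world that sees
-- everything and is seen by everyone: the resulting frame is dense, and since
-- p is false at the apex the guarded boxes of τ_p φ never look at it.
module Submission where

open import Defs
open import Data.Nat using (ℕ; _≡ᵇ_)
open import Data.Nat.Properties using (≡ᵇ⇒≡; ≡⇒≡ᵇ)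
open import Data.Bool using (Bool; true; false; if_then_else_)
open import Data.Bool.Properties using (T-≡) renaming (_≟_ to _≟ᵇ_)
open import Data.Unit using (⊤; tt)
open import Data.Sum using (_⊎_; inj₁; inj₂)
open import Data.Product using (_×_) renaming (_,_ to _&_)
open import Data.Product.Function.NonDependent.Propositional using (_×-⇔_)
open import Function.Base using (id)
open import Function.Construct.Identity using (⇔-id)
open import Function.Bundles using (_⇔_; mk⇔; Equivalence)
open import Function.Related.TypeIsomorphisms using (¬-cong-⇔)
open import Relation.Nullary using (¬_)
open import Relation.Nullary.Negation using (Stable; negated-stable; contradiction)
open import Relation.Nullary.Decidable using (decidable-stable)
open import Relation.Binary.PropositionalEquality using (_≡_; _≢_; refl; sym)

open Equivalence

private
  ∨-cong-⇔ : {A B C D : Set} → A ⇔ B → C ⇔ D →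
             (¬ (¬ A × ¬ C)) ⇔ (¬ (¬ B × ¬ D))
  ∨-cong-⇔ A⇔B C⇔D = ¬-cong-⇔ (¬-cong-⇔ A⇔B ×-⇔ ¬-cong-⇔ C⇔D)

⊨-stable : (F : Frame) (V : Valuation F) (w : W F) (φ : Form) → Stable (F , V , w ⊨ φ)
⊨-stable F V w (atom q) = decidable-stable (V w q ≟ᵇ true)
⊨-stable F V w ⊥'       ¬¬⊥ = ¬¬⊥ id
⊨-stable F V w (¬' φ)   = negated-stable
⊨-stable F V w (φ ∨' ψ) = negated-stable
⊨-stable F V w (□ φ)    ¬¬□φ v wRv =
  ⊨-stable F V v φ (λ ¬φ → ¬¬□φ (λ □φ → ¬φ (□φ v wRv)))

restrictTo : (F : Frame) → (W F → Set) → Frame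
restrictTo F P = record
  { W = W F ; R = λ w v → R F w v × P v ; inhabited = inhabited F }

Holds : {A : Set} → (A → ℕ → Bool) → ℕ → A → Set
Holds V p v = V v p ≡ true

module _ (F : Frame) (V : Valuation F) (p : ℕ) where

  ⊨-restrictTo⇔⊨τ : (w : W F) (ψ : Form) →
                     (restrictTo F (Holds V p) , V , w ⊨ ψ) ⇔ (F , V , w ⊨ τ p ψ)
  ⊨-restrictTo⇔⊨τ w (atom q) = ⇔-id _
  ⊨-restrictTo⇔⊨τ w ⊥'       = ⇔-id _
  ⊨-restrictTo⇔⊨τ w (¬' ψ)   = ¬-cong-⇔ (⊨-restrictTo⇔⊨τ w ψ)
  ⊨-restrictTo⇔⊨τ w (ψ ∨' χ) = ∨-cong-⇔ (⊨-restrictTo⇔⊨τ w ψ) (⊨-restrictTo⇔⊨τ w χ)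
  ⊨-restrictTo⇔⊨τ w (□ ψ)    = mk⇔
    (λ □ψ v wRv (¬¬pv & ¬τψ) →
       ¬τψ (to (⊨-restrictTo⇔⊨τ v ψ) (□ψ v (wRv & ⊨-stable F V v (atom p) ¬¬pv))))
    (λ □τψ v (wRv & pv) → from (⊨-restrictTo⇔⊨τ v ψ)
       (⊨-stable F V v (τ p ψ) (λ ¬τψ → □τψ v wRv ((λ ¬pv → ¬pv pv) & ¬τψ))))

module _ (F : Frame) (V : Valuation F) (p : ℕ) (everywhere : ∀ v → Holds V p v) where

  ⊨τ⇔⊨-if-everywhere : (w : W F) (ψ : Form) → (F , V , w ⊨ τ p ψ) ⇔ (F , V , w ⊨ ψ)
  ⊨τ⇔⊨-if-everywhere w (atom q) = ⇔-id _
  ⊨τ⇔⊨-if-everywhere w ⊥'       = ⇔-id _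
  ⊨τ⇔⊨-if-everywhere w (¬' ψ)   = ¬-cong-⇔ (⊨τ⇔⊨-if-everywhere w ψ)
  ⊨τ⇔⊨-if-everywhere w (ψ ∨' χ) = ∨-cong-⇔ (⊨τ⇔⊨-if-everywhere w ψ) (⊨τ⇔⊨-if-everywhere w χ)
  ⊨τ⇔⊨-if-everywhere w (□ ψ)    = mk⇔
    (λ □τψ v wRv → to (⊨τ⇔⊨-if-everywhere v ψ)
       (⊨-stable F V v (τ p ψ) (λ ¬τψ → □τψ v wRv ((λ ¬pv → ¬pv (everywhere v)) & ¬τψ))))
    (λ □ψ v wRv (_ & ¬τψ) → ¬τψ (from (⊨τ⇔⊨-if-everywhere v ψ) (□ψ v wRv)))

_[_≔true] : {A : Set} → (A → ℕ → Bool) → ℕ → A → ℕ → Bool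
(V [ p ≔true]) w q = if q ≡ᵇ p then true else V w q

≔true-holds : {A : Set} (V : A → ℕ → Bool) (p : ℕ) (w : A) → Holds (V [ p ≔true]) p w
≔true-holds V p w rewrite to T-≡ (≡⇒≡ᵇ p p refl) = refl

≔true-other : {A : Set} (V : A → ℕ → Bool) {p q : ℕ} → p ≢ q → (w : A) →
              (V [ p ≔true]) w q ≡ V w q
≔true-other V {p} {q} p≢q w with q ≡ᵇ p in q≡ᵇp
... | true  = contradiction (sym (≡ᵇ⇒≡ q p (from T-≡ q≡ᵇp))) p≢q
... | false = refl

module _ (F : Frame) (V V′ : Valuation F) (p : ℕ)
         (agree : ∀ {q} → p ≢ q → ∀ w → V w q ≡ V′ w q) where

  ⊨-agree-off : (w : W F) (ψ : Form) → ¬ Occurs p ψ → (F , V , w ⊨ ψ) ⇔ (F , V′ , w ⊨ ψ)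
  ⊨-agree-off w (atom q) p∉ rewrite agree p∉ w = ⇔-id _
  ⊨-agree-off w ⊥'       p∉ = ⇔-id _
  ⊨-agree-off w (¬' ψ)   p∉ = ¬-cong-⇔ (⊨-agree-off w ψ p∉)
  ⊨-agree-off w (ψ ∨' χ) p∉ =
    ∨-cong-⇔ (⊨-agree-off w ψ (λ p∈ψ → p∉ (inj₁ p∈ψ))) (⊨-agree-off w χ (λ p∈χ → p∉ (inj₂ p∈χ)))
  ⊨-agree-off w (□ ψ)    p∉ = mk⇔
    (λ □ψ v wRv → to   (⊨-agree-off v ψ p∉) (□ψ v wRv))
    (λ □ψ v wRv → from (⊨-agree-off v ψ p∉) (□ψ v wRv))

data ApexR (F : Frame) : W F ⊎ ⊤ → W F ⊎ ⊤ → Set where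
  old      : ∀ {w v} → R F w v → ApexR F (inj₁ w) (inj₁ v)
  toApex   : ∀ {w} → ApexR F w (inj₂ tt)
  fromApex : ∀ {v} → ApexR F (inj₂ tt) v

withApex : Frame → Frame
withApex F = record { W = W F ⊎ ⊤ ; R = ApexR F ; inhabited = inj₂ tt }

withApex-dense : (F : Frame) → Dense (withApex F)
withApex-dense F _ = inj₂ tt & toApex & fromApex

apexFalse : {A : Set} → (A → ℕ → Bool) → A ⊎ ⊤ → ℕ → Bool
apexFalse V (inj₁ w) q = V w q
apexFalse V (inj₂ _) q = false

module _ (F : Frame) (V : Valuation F) (p : ℕ) where

  ⊨τ-withApex⇔⊨τ : (w : W F) (ψ : Form) →
                    (withApex F , apexFalse V , inj₁ w ⊨ τ p ψ) ⇔ (F , V , w ⊨ τ p ψ)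
  ⊨τ-withApex⇔⊨τ w (atom q) = ⇔-id _
  ⊨τ-withApex⇔⊨τ w ⊥'       = ⇔-id _
  ⊨τ-withApex⇔⊨τ w (¬' ψ)   = ¬-cong-⇔ (⊨τ-withApex⇔⊨τ w ψ)
  ⊨τ-withApex⇔⊨τ w (ψ ∨' χ) = ∨-cong-⇔ (⊨τ-withApex⇔⊨τ w ψ) (⊨τ-withApex⇔⊨τ w χ)
  ⊨τ-withApex⇔⊨τ w (□ ψ)    = mk⇔ restrict extend
    where
    restrict : withApex F , apexFalse V , inj₁ w ⊨ τ p (□ ψ) → F , V , w ⊨ τ p (□ ψ)
    restrict □τψ v wRv (¬¬pv & ¬τψ) =
      □τψ (inj₁ v) (old wRv) (¬¬pv & λ τψ → ¬τψ (to (⊨τ-withApex⇔⊨τ v ψ) τψ))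

    extend : F , V , w ⊨ τ p (□ ψ) → withApex F , apexFalse V , inj₁ w ⊨ τ p (□ ψ)
    extend □τψ (inj₁ v) (old wRv) (¬¬pv & ¬τψ) =
      □τψ v wRv (¬¬pv & λ τψ → ¬τψ (from (⊨τ-withApex⇔⊨τ v ψ) τψ))
    extend □τψ (inj₂ _) toApex    (¬¬pv & _)   = ¬¬pv (λ ())

lemma2 : (p : ℕ) (φ : Form) → ¬ Occurs p φ →
    (ValidAll φ ⇔ ValidAll (τ p φ)) × (ValidAll (τ p φ) ⇔ ValidDense (τ p φ))
lemma2 p φ p∉φ =
  mk⇔ valid⇒validτ validτ⇒valid & mk⇔ (λ ⊨τφ F _ → ⊨τφ F) denseValidτ⇒validτ
  where
  valid⇒validτ : ValidAll φ → ValidAll (τ p φ)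
  valid⇒validτ ⊨φ F V w =
    to (⊨-restrictTo⇔⊨τ F V p w φ) (⊨φ (restrictTo F (Holds V p)) V w)

  validτ⇒valid : ValidAll (τ p φ) → ValidAll φ
  validτ⇒valid ⊨τφ F V w =
    to (⊨-agree-off F (V [ p ≔true]) V p (≔true-other V) w φ p∉φ)
       (to (⊨τ⇔⊨-if-everywhere F (V [ p ≔true]) p (≔true-holds V p) w φ)
           (⊨τφ F (V [ p ≔true]) w))

  denseValidτ⇒validτ : ValidDense (τ p φ) → ValidAll (τ p φ)
  denseValidτ⇒validτ ⊨τφ F V w =
    to (⊨τ-withApex⇔⊨τ F V p w φ)
       (⊨τφ (withApex F) (withApex-dense F) (apexFalse V) (inj₁ w))
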